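{- Let $m\geq 3$ and $n$ be integers, let $c$ be an admissible edge-colouring of $K_n$, let $k$ be a positive integer, and let $A,B$ be disjoint subsets of $V(K_n)$ with $|A|\leq k$ and $|B|\leq k$. Then \[ \sigma_c(A,B) \leq k^{3/2}\sqrt m . \]
   Context: Fix an integer $m\geq 3$. An edge-colouring of the complete graph $K_n$ is called admissible if $K_n$ contains no monochromatic complete subgraph on $m$ vertices (all edges of the same colour) and no rainbow complete subgraph on $4$ vertices (all six edges of pairwise distinct colours). For an edge-colouring $c$ of $K_n$ and disjoint sets $A,B\subset V(K_n)$, $S_c(A,B)$ denotes the set of colours that are used by $c$ but only on edges joining a vertex of $A$ to a vertex of $B$ (i.e. colours appearing on at least one edge and appearing on no edge other than $A$–$B$ edges), and $\sigma_c(A,B)=|S_c(A,B)|$. -}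

module Defs where

open import Data.Nat using (ℕ; _≟_)
open import Data.Fin using (Fin)
open import Data.Fin.Subset using (Subset; _∈_; Empty; _∩_)
open import Data.Fin.Subset.Properties using (_∈?_)
open import Data.List using (List; []; _∷_; filter; length; allFin; concatMap; deduplicate)
open import Data.List.Relation.Unary.All using (All)
open import Data.List.Relation.Unary.All.Properties using ()
open import Data.Product using (_×_; Σ; ∃; _,_)
open import Data.Sum using (_⊎_)
open import Relation.Nullary using (¬_; Dec; yes; no)
open import Relation.Nullary.Decidable using (_⊎-dec_; _×-dec_; ¬?; _→-dec_)
open import Relation.Binary.PropositionalEquality using (_≡_; _≢_)
import Data.Fin as F
import Data.Fin.Properties as FP
import Data.List.Relation.Unary.All as All

-- An edge-colouring of K_n: colours are natural numbers; c u v is the colour of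
-- the edge uv (for u ≢ v); symmetry is required.
Colouring : ℕ → Set
Colouring n = Fin n → Fin n → ℕ

Symmetric : ∀ {n} → Colouring n → Set
Symmetric {n} c = ∀ (u v : Fin n) → c u v ≡ c v u

Distinct4 : ∀ {n} → Fin n → Fin n → Fin n → Fin n → Set
Distinct4 a b x d = a ≢ b × a ≢ x × a ≢ d × b ≢ x × b ≢ d × x ≢ d

RainbowK4 : ∀ {n} → Colouring n → Fin n → Fin n → Fin n → Fin n → Set
RainbowK4 c a b x d =
  Distinct4 a b x d ×
  (let e1 = c a b ; e2 = c a x ; e3 = c a d ; e4 = c b x ; e5 = c b d ; e6 = c x d in
    e1 ≢ e2 × e1 ≢ e3 × e1 ≢ e4 × e1 ≢ e5 × e1 ≢ e6 ×
    e2 ≢ e3 × e2 ≢ e4 × e2 ≢ e5 × e2 ≢ e6 ×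
    e3 ≢ e4 × e3 ≢ e5 × e3 ≢ e6 ×
    e4 ≢ e5 × e4 ≢ e6 ×
    e5 ≢ e6)

MonoKm : ∀ {n} → Colouring n → ℕ → Set
MonoKm {n} c m = Σ (Fin m → Fin n) λ f →
  (∀ i j → f i ≡ f j → i ≡ j) ×
  Σ ℕ λ col → ∀ i j → i ≢ j → c (f i) (f j) ≡ col

Admissible : ∀ {n} → ℕ → Colouring n → Set
Admissible {n} m c =
  Symmetric c ×
  ¬ MonoKm c m ×
  (∀ (a b x d : Fin n) → ¬ RainbowK4 c a b x d)

JoinsAB : ∀ {n} → Subset n → Subset n → Fin n → Fin n → Set
JoinsAB A B u v = (u ∈ A × v ∈ B) ⊎ (u ∈ B × v ∈ A)

InS : ∀ {n} → Colouring n → Subset n → Subset n → ℕ → Set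
InS {n} c A B col =
  (Σ (Fin n) λ u → Σ (Fin n) λ v → u ≢ v × c u v ≡ col) ×
  (∀ (u v : Fin n) → u ≢ v → c u v ≡ col → JoinsAB A B u v)

private
  allPairs : ∀ n → List (Fin n × Fin n)
  allPairs n = concatMap (λ u → Data.List.map (λ v → u , v) (allFin n)) (allFin n)

open import Data.List using (map)
open import Data.Fin.Properties using (any?; all?)

InS? : ∀ {n} (c : Colouring n) (A B : Subset n) (col : ℕ) → Dec (InS c A B col)
InS? {n} c A B col =
  any? (λ u → any? (λ v → ¬? (u F.≟ v) ×-dec (c u v ≟ col)))
  ×-dec
  all? (λ u → all? (λ v → ¬? (u F.≟ v) →-dec ((c u v ≟ col) →-dec
        (((u ∈? A) ×-dec (v ∈? B)) ⊎-dec ((u ∈? B) ×-dec (v ∈? A))))))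

edgeColours : ∀ {n} → Colouring n → List ℕ
edgeColours {n} c = map (λ p → c (Data.Product.proj₁ p) (Data.Product.proj₂ p))
  (filter (λ p → ¬? (Data.Product.proj₁ p F.≟ Data.Product.proj₂ p)) (allPairs n))

Sc : ∀ {n} → Colouring n → Subset n → Subset n → List ℕ
Sc c A B = deduplicate _≟_ (filter (InS? c A B) (edgeColours c))

σ : ∀ {n} → Colouring n → Subset n → Subset n → ℕ
σ c A B = length (Sc c A B)

module Submission where

-- Pick for every colour of S_c(A, B) a representative edge; its A-end and B-end label it.
-- These s = σ_c(A, B) labels name distinct A–B edges, so s ≤ |A|·|B|.  Counting ordered
-- pairs of labels with a common B-end, Cauchy–Schwarz over the B-degrees gives
-- s² ≤ |B|·(s + #{pairs with a common B-end but different A-ends}).  Grouping such pairs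
-- by their A-ends x ≠ y, each group is a "double fan": labels at x whose B-ends are all
-- also joined to y by a label.  In a double fan with m labels, any two B-ends z, w span a
-- K₄ {x, y, z, w} whose four A–B edges carry four distinct S-colours, which cannot appear
-- inside A or B; avoiding a rainbow K₄ forces c(zw) = c(xy), so the B-ends form a
-- monochromatic K_m.  Hence groups have fewer than m labels, the pair count is at most
-- (m − 1)|A|², and s² ≤ k(k² + (m − 1)k²) = k³m.

open import Defs

open import Data.Nat using (ℕ; zero; suc; _+_; _*_; _^_; _≤_; z≤n; s≤s; _≟_)
open import Data.Nat.Properties
open import Data.Nat.Tactic.RingSolver using (solve-∀)
open import Data.Fin using (Fin; zero; suc)
import Data.Fin as Fin
import Data.Fin.Properties as Fin
open import Data.Fin.Subset using (Subset; ∣_∣; inside; outside; _∈_; Empty; _∩_)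
open import Data.Fin.Subset.Properties using (_∈?_; drop-there; x∈p∩q⁺)
open import Data.Vec using ([]; _∷_; there)
open import Data.Product using (Σ; ∃; _×_; _,_; proj₁; proj₂)
open import Data.Sum using (_⊎_; inj₁; inj₂)
open import Data.Empty using (⊥; ⊥-elim)
open import Function using (_∘_)
open import Function.Definitions using (Injective)
open import Relation.Nullary using (¬_; Dec; yes; no; contradiction; ¬?)
open import Relation.Binary.PropositionalEquality
open import Data.List using (List; lookup; filter)
open import Data.List.Membership.Propositional.Properties using (∈-lookup; ∈-filter⁻; ∈-deduplicate⁻)
import Data.List.Relation.Unary.All as All
open import Data.List.Relation.Unary.AllPairs using (AllPairs; _∷_)
open import Data.List.Relation.Unary.Unique.DecPropositional.Properties _≟_ using (deduplicate-!)
open import Algebra.Properties.Semiring.Sum +-*-semiring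
  using (sum; sum-syntax; sum-cong-≗; ∑-distrib-+; ∑-comm; *-distribˡ-sum; *-distribʳ-sum)

sum-mono : ∀ {n} {f g : Fin n → ℕ} → (∀ i → f i ≤ g i) → sum f ≤ sum g
sum-mono {zero}  f≤g = z≤n
sum-mono {suc n} f≤g = +-mono-≤ (f≤g zero) (sum-mono (f≤g ∘ suc))

sum-zero : ∀ {n} {f : Fin n → ℕ} → (∀ i → f i ≡ 0) → sum f ≡ 0
sum-zero {zero}  f≡0 = refl
sum-zero {suc n} f≡0 = cong₂ _+_ (f≡0 zero) (sum-zero (f≡0 ∘ suc))

sum-ones : ∀ n → ∑[ i < n ] 1 ≡ n
sum-ones zero    = refl
sum-ones (suc n) = cong suc (sum-ones n)

term≤sum : ∀ {n} (f : Fin n → ℕ) i → f i ≤ sum f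
term≤sum f zero    = m≤m+n (f zero) _
term≤sum f (suc i) = ≤-trans (term≤sum (f ∘ suc) i) (m≤n+m _ (f zero))

sum-*-sum : ∀ {m n} (f : Fin m → ℕ) (g : Fin n → ℕ) →
  sum f * sum g ≡ ∑[ i < m ] ∑[ j < n ] (f i * g j)
sum-*-sum f g = trans (*-distribʳ-sum (sum g) f)
                      (sum-cong-≗ (λ i → *-distribˡ-sum (f i) g))

double-sum-scale : ∀ {m n} k (f : Fin m → Fin n → ℕ) →
  k * ∑[ i < m ] ∑[ j < n ] f i j ≡ ∑[ i < m ] ∑[ j < n ] (k * f i j)
double-sum-scale {m} k f = trans (*-distribˡ-sum {m} k _) (sum-cong-≗ (λ i → *-distribˡ-sum k (f i)))

double-sum-+ : ∀ {m n} (f g : Fin m → Fin n → ℕ) →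
  ∑[ i < m ] ∑[ j < n ] (f i j + g i j) ≡ ∑[ i < m ] ∑[ j < n ] f i j + ∑[ i < m ] ∑[ j < n ] g i j
double-sum-+ {m} {n} f g = trans (sum-cong-≗ (λ i → ∑-distrib-+ {n} (f i) (g i))) (∑-distrib-+ {m} _ _)

-- 2pq ≤ p² + q², first when p ≤ q: writing q = p + d the gap is exactly d²
2pq≤p²+q²-ordered : ∀ {p q} → p ≤ q → 2 * (p * q) ≤ p * p + q * q
2pq≤p²+q²-ordered {p} p≤q with m≤n⇒∃[o]m+o≡n p≤q
... | d , refl = subst (2 * (p * (p + d)) ≤_) (expand p d) (m≤m+n _ (d * d))
  where
  expand : ∀ p d → 2 * (p * (p + d)) + d * d ≡ p * p + (p + d) * (p + d)
  expand = solve-∀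

2pq≤p²+q² : ∀ p q → 2 * (p * q) ≤ p * p + q * q
2pq≤p²+q² p q with ≤-total p q
... | inj₁ p≤q = 2pq≤p²+q²-ordered p≤q
... | inj₂ q≤p = subst₂ _≤_ (cong (2 *_) (*-comm q p)) (+-comm (q * q) (p * p))
                   (2pq≤p²+q²-ordered q≤p)

-- Cauchy–Schwarz: (∑ uᵢxᵢ)² ≤ (∑ uᵢ²)(∑ xᵢ²).  Doubling both sides, it is the sum over
-- all i, j of the pointwise bound 2(uᵢxᵢ)(uⱼxⱼ) ≤ uᵢ²xⱼ² + uⱼ²xᵢ².
cauchy-schwarz : ∀ {n} (u x : Fin n → ℕ) →
  sum (λ i → u i * x i) * sum (λ i → u i * x i) ≤ sum (λ i → u i * u i) * sum (λ i → x i * x i)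
cauchy-schwarz {n} u x = *-cancelˡ-≤ 2 (begin
    2 * (sum ux * sum ux)
  ≡⟨ cong (2 *_) (sum-*-sum ux ux) ⟩
    2 * ∑[ i < n ] ∑[ j < n ] (ux i * ux j)
  ≡⟨ double-sum-scale 2 (λ i j → ux i * ux j) ⟩
    ∑[ i < n ] ∑[ j < n ] (2 * (ux i * ux j))
  ≤⟨ sum-mono (λ i → sum-mono (λ j → pointwise i j)) ⟩
    ∑[ i < n ] ∑[ j < n ] (uu i * xx j + uu j * xx i)
  ≡⟨ double-sum-+ (λ i j → uu i * xx j) (λ i j → uu j * xx i) ⟩
    ∑[ i < n ] ∑[ j < n ] (uu i * xx j) + ∑[ i < n ] ∑[ j < n ] (uu j * xx i)
  ≡⟨ cong (∑[ i < n ] ∑[ j < n ] (uu i * xx j) +_) (∑-comm (λ i j → uu j * xx i)) ⟩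
    ∑[ i < n ] ∑[ j < n ] (uu i * xx j) + ∑[ j < n ] ∑[ i < n ] (uu j * xx i)
  ≡⟨ cong₂ _+_ (sym (sum-*-sum uu xx)) (sym (sum-*-sum uu xx)) ⟩
    sum uu * sum xx + sum uu * sum xx
  ≡⟨ cong (sum uu * sum xx +_) (sym (+-identityʳ _)) ⟩
    2 * (sum uu * sum xx) ∎)
  where
  open ≤-Reasoning
  ux uu xx : Fin n → ℕ
  ux i = u i * x i
  uu i = u i * u i
  xx i = x i * x i

  pointwise : ∀ i j → 2 * (ux i * ux j) ≤ uu i * xx j + uu j * xx i
  pointwise i j = subst₂ _≤_ (lhs (u i) (x i) (u j) (x j)) (rhs (u i) (x i) (u j) (x j))
                    (2pq≤p²+q² (u i * x j) (u j * x i))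
    where
    lhs : ∀ a b c d → 2 * ((a * d) * (c * b)) ≡ 2 * ((a * b) * (c * d))
    lhs = solve-∀
    rhs : ∀ a b c d → (a * d) * (a * d) + (c * b) * (c * b) ≡ (a * a) * (d * d) + (c * c) * (b * b)
    rhs = solve-∀

sum-≤1 : ∀ {n} {f : Fin n → ℕ} → (∀ i → f i ≤ 1) →
  (∀ i j → 1 ≤ f i → 1 ≤ f j → i ≡ j) → sum f ≤ 1
sum-≤1 {zero}          f≤1 unique = z≤n
sum-≤1 {suc n} {f} f≤1 unique with f zero in f₀
... | zero  = sum-≤1 (f≤1 ∘ suc) (λ i j p q → Fin.suc-injective (unique (suc i) (suc j) p q))
... | suc k = begin
    suc k + sum (f ∘ suc) ≡⟨ cong (suc k +_) (sum-zero rest-vanishes) ⟩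
    suc k + 0             ≡⟨ +-identityʳ (suc k) ⟩
    suc k                 ≡⟨ f₀ ⟨
    f zero                ≤⟨ f≤1 zero ⟩
    1                     ∎
  where
  open ≤-Reasoning
  rest-vanishes : ∀ i → f (suc i) ≡ 0
  rest-vanishes i = n<1⇒n≡0 (≰⇒> λ pos →
    0≢1+n (cong Fin.toℕ (unique zero (suc i) (subst (1 ≤_) (sym f₀) (s≤s z≤n)) pos)))

sum-pos : ∀ {n} (f : Fin n → ℕ) → 1 ≤ sum f → ∃ λ i → 1 ≤ f i
sum-pos {suc n} f pos with f zero in f₀
... | suc _ = zero , subst (1 ≤_) (sym f₀) (s≤s z≤n)
... | zero with sum-pos (f ∘ suc) pos
...   | i , fᵢ>0 = suc i , fᵢ>0

sum-≥ : ∀ {n} m (f : Fin n → ℕ) → (∀ i → f i ≤ 1) → m ≤ sum f →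
  Σ (Fin m → Fin n) λ g → Injective _≡_ _≡_ g × (∀ u → 1 ≤ f (g u))
sum-≥ {zero}  zero    f f≤1 m≤∑ = (λ ()) , (λ {}) , (λ ())
sum-≥ {suc n} m       f f≤1 m≤∑ with f zero in f₀
sum-≥ {suc n} m       f f≤1 m≤∑ | zero with sum-≥ m (f ∘ suc) (f≤1 ∘ suc) m≤∑
... | g , g-inj , g-pos = suc ∘ g , g-inj ∘ Fin.suc-injective , g-pos
sum-≥ {suc n} zero    f f≤1 m≤∑ | suc _ = (λ ()) , (λ {}) , (λ ())
sum-≥ {suc n} (suc m) f f≤1 m≤∑ | suc k
  with sum-≥ m (f ∘ suc) (f≤1 ∘ suc) (tail-bound (subst (_≤ 1) f₀ (f≤1 zero)))
  where
  tail-bound : suc k ≤ 1 → m ≤ sum (f ∘ suc)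
  tail-bound (s≤s z≤n) = ≤-pred m≤∑
... | g , g-inj , g-pos = extend , extend-inj , extend-pos
  where
  extend : Fin (suc m) → Fin (suc n)
  extend zero    = zero
  extend (suc u) = suc (g u)
  extend-inj : Injective _≡_ _≡_ extend
  extend-inj {zero}  {zero}  _ = refl
  extend-inj {suc u} {suc v} e = cong suc (g-inj (Fin.suc-injective e))
  extend-pos : ∀ u → 1 ≤ f (extend u)
  extend-pos zero    = subst (1 ≤_) (sym f₀) (s≤s z≤n)
  extend-pos (suc u) = g-pos u

𝟙 : ∀ {p} {P : Set p} → Dec P → ℕ
𝟙 (yes _) = 1
𝟙 (no _)  = 0

module _ {p} {P : Set p} where

  𝟙-≤1 : (d : Dec P) → 𝟙 d ≤ 1
  𝟙-≤1 (yes _) = s≤s z≤n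
  𝟙-≤1 (no _)  = z≤n

  𝟙-true : P → (d : Dec P) → 𝟙 d ≡ 1
  𝟙-true _  (yes _) = refl
  𝟙-true pr (no ¬p) = contradiction pr ¬p

  𝟙-false : ¬ P → (d : Dec P) → 𝟙 d ≡ 0
  𝟙-false ¬p (yes pr) = contradiction pr ¬p
  𝟙-false _  (no _)   = refl

  𝟙-sound : (d : Dec P) → 1 ≤ 𝟙 d → P
  𝟙-sound (yes pr) _ = pr

  𝟙-idem : (d : Dec P) → 𝟙 d * 𝟙 d ≡ 𝟙 d
  𝟙-idem (yes _) = refl
  𝟙-idem (no _)  = refl

  𝟙*-sound : (d : Dec P) {k : ℕ} → 1 ≤ 𝟙 d * k → P × 1 ≤ k
  𝟙*-sound (yes pr) {k} pos = pr , subst (1 ≤_) (+-identityʳ k) pos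

  𝟙*-≤1 : (d : Dec P) {k : ℕ} → k ≤ 1 → 𝟙 d * k ≤ 1
  𝟙*-≤1 (yes _) {k} k≤1 = subst (_≤ 1) (sym (+-identityʳ k)) k≤1
  𝟙*-≤1 (no _)      _   = z≤n

  𝟙*-false : ¬ P → (d : Dec P) (k : ℕ) → 𝟙 d * k ≡ 0
  𝟙*-false ¬p d k = cong (_* k) (𝟙-false ¬p d)

𝟙-cong : ∀ {p q} {P : Set p} {Q : Set q} → (P → Q) → (Q → P) →
  (d : Dec P) (e : Dec Q) → 𝟙 d ≡ 𝟙 e
𝟙-cong P⇒Q Q⇒P (yes pr) e = sym (𝟙-true (P⇒Q pr) e)
𝟙-cong P⇒Q Q⇒P (no ¬p)  e = sym (𝟙-false (¬p ∘ Q⇒P) e)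

δ : ∀ {n} → Fin n → Fin n → ℕ
δ x y = 𝟙 (x Fin.≟ y)

χ : ∀ {n} → Subset n → Fin n → ℕ
χ A x = 𝟙 (x ∈? A)

χ-tail : ∀ {n} b (A : Subset n) x → χ (b ∷ A) (suc x) ≡ χ A x
χ-tail b A x = 𝟙-cong drop-there there (suc x ∈? (b ∷ A)) (x ∈? A)

sum-χ : ∀ {n} (A : Subset n) → sum (χ A) ≡ ∣ A ∣
sum-χ {zero}  []            = refl
sum-χ {suc n} (inside ∷ A)  = cong suc (trans (sum-cong-≗ (χ-tail inside A)) (sum-χ A))
sum-χ {suc n} (outside ∷ A) = trans (sum-cong-≗ (χ-tail outside A)) (sum-χ A)

sum-δ : ∀ {n} (a : Fin n) → ∑[ x < n ] δ a x ≡ 1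
sum-δ a = ≤-antisym
  (sum-≤1 (λ x → 𝟙-≤1 (a Fin.≟ x))
          (λ x y p q → trans (sym (𝟙-sound (a Fin.≟ x) p)) (𝟙-sound (a Fin.≟ y) q)))
  (subst (_≤ sum (δ a)) (𝟙-true refl (a Fin.≟ a)) (term≤sum (δ a) a))

sum-fibres : ∀ {s n} (g : Fin s → Fin n) (f : Fin s → ℕ) →
  sum f ≡ ∑[ x < n ] ∑[ i < s ] (δ (g i) x * f i)
sum-fibres {s} {n} g f = trans (sum-cong-≗ spread) (∑-comm (λ i x → δ (g i) x * f i))
  where
  spread : ∀ i → f i ≡ ∑[ x < n ] (δ (g i) x * f i)
  spread i = begin
    f i                       ≡⟨ +-identityʳ (f i) ⟨
    1 * f i                   ≡⟨ cong (_* f i) (sum-δ (g i)) ⟨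
    sum (δ (g i)) * f i       ≡⟨ *-distribʳ-sum (f i) (δ (g i)) ⟩
    ∑[ x < n ] (δ (g i) x * f i) ∎
    where open ≡-Reasoning

module LabelledEdges {n s : ℕ} (A B : Subset n) (a b : Fin s → Fin n)
  (a∈A : ∀ i → a i ∈ A) (b∈B : ∀ i → b i ∈ B)
  (edges-distinct : ∀ i j → a i ≡ a j → b i ≡ b j → i ≡ j) where

  DoubleFan : ℕ → Fin n → Fin n → Set
  DoubleFan m x y = Σ (Fin m → Fin s) λ g → Injective _≡_ _≡_ g ×
    (∀ u → a (g u) ≡ x) × (∀ u → ∃ λ j → a j ≡ y × b j ≡ b (g u))

  a-outside : ∀ {x} → ¬ x ∈ A → ∀ i → a i ≢ x
  a-outside x∉A i a≡x = x∉A (subst (_∈ A) a≡x (a∈A i))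

  b-outside : ∀ {y} → ¬ y ∈ B → ∀ i → b i ≢ y
  b-outside y∉B i b≡y = y∉B (subst (_∈ B) b≡y (b∈B i))

  edge-multiplicity : ∀ x y → ∑[ i < s ] (δ (b i) y * (δ (a i) x * 1)) ≤ χ A x * χ B y
  edge-multiplicity x y with x ∈? A | y ∈? B
  ... | yes _ | yes _ = sum-≤1
    (λ i → 𝟙*-≤1 (b i Fin.≟ y) (𝟙*-≤1 (a i Fin.≟ x) ≤-refl))
    (λ i j pᵢ pⱼ → edges-distinct i j (trans (a≡x pᵢ) (sym (a≡x pⱼ))) (trans (b≡y pᵢ) (sym (b≡y pⱼ))))
    where
    b≡y : ∀ {i} → 1 ≤ δ (b i) y * (δ (a i) x * 1) → b i ≡ y
    b≡y {i} p = proj₁ (𝟙*-sound (b i Fin.≟ y) p)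
    a≡x : ∀ {i} → 1 ≤ δ (b i) y * (δ (a i) x * 1) → a i ≡ x
    a≡x {i} p = proj₁ (𝟙*-sound (a i Fin.≟ x) (proj₂ (𝟙*-sound (b i Fin.≟ y) p)))
  ... | no x∉A | _ = ≤-reflexive (sum-zero λ i →
    trans (cong (δ (b i) y *_) (𝟙*-false (a-outside x∉A i) (a i Fin.≟ x) 1))
          (*-zeroʳ (δ (b i) y)))
  ... | yes _ | no y∉B = ≤-reflexive (sum-zero λ i →
    𝟙*-false (b-outside y∉B i) (b i Fin.≟ y) _)

  labels≤ : s ≤ ∣ A ∣ * ∣ B ∣
  labels≤ = begin
    s                                                      ≡⟨ sum-ones s ⟨
    ∑[ i < s ] 1                                           ≡⟨ sum-fibres a (λ _ → 1) ⟩
    ∑[ x < n ] ∑[ i < s ] (δ (a i) x * 1)                  ≡⟨ sum-cong-≗ (λ x → sum-fibres b (λ i → δ (a i) x * 1)) ⟩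
    ∑[ x < n ] ∑[ y < n ] ∑[ i < s ] (δ (b i) y * (δ (a i) x * 1))
                                                           ≤⟨ sum-mono (λ x → sum-mono (edge-multiplicity x)) ⟩
    ∑[ x < n ] ∑[ y < n ] (χ A x * χ B y)                  ≡⟨ sum-*-sum (χ A) (χ B) ⟨
    sum (χ A) * sum (χ B)                                  ≡⟨ cong₂ _*_ (sum-χ A) (sum-χ B) ⟩
    ∣ A ∣ * ∣ B ∣                                            ∎
    where open ≤-Reasoning

  deg : Fin n → ℕ
  deg y = ∑[ i < s ] δ (b i) y

  labels-by-degree : s ≡ sum deg
  labels-by-degree = begin
    s                                      ≡⟨ sum-ones s ⟨
    ∑[ i < s ] 1                           ≡⟨ sum-fibres b (λ _ → 1) ⟩
    ∑[ y < n ] ∑[ i < s ] (δ (b i) y * 1)  ≡⟨ sum-cong-≗ (λ y → sum-cong-≗ (λ i → *-identityʳ (δ (b i) y))) ⟩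
    sum deg                                ∎
    where open ≡-Reasoning

  deg-supported : ∀ y → χ B y * deg y ≡ deg y
  deg-supported y with y ∈? B
  ... | yes _  = +-identityʳ (deg y)
  ... | no y∉B = sym (sum-zero λ i → 𝟙-false (b-outside y∉B i) (b i Fin.≟ y))

  shareB : ℕ
  shareB = ∑[ i < s ] ∑[ j < s ] δ (b i) (b j)

  shareB-by-degree : shareB ≡ ∑[ y < n ] (deg y * deg y)
  shareB-by-degree = begin
    shareB                                       ≡⟨ sum-cong-≗ (λ i → sum-cong-≗ (λ j → δ-sym (b i) (b j))) ⟩
    ∑[ i < s ] deg (b i)                         ≡⟨ sum-fibres b (deg ∘ b) ⟩
    ∑[ y < n ] ∑[ i < s ] (δ (b i) y * deg (b i)) ≡⟨ sum-cong-≗ (λ y → sum-cong-≗ (λ i → on-fibre y i)) ⟩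
    ∑[ y < n ] ∑[ i < s ] (δ (b i) y * deg y)    ≡⟨ sum-cong-≗ (λ y → *-distribʳ-sum (deg y) (λ i → δ (b i) y)) ⟨
    ∑[ y < n ] (deg y * deg y)                   ∎
    where
    open ≡-Reasoning
    δ-sym : ∀ x y → δ x y ≡ δ y x
    δ-sym x y = 𝟙-cong sym sym (x Fin.≟ y) (y Fin.≟ x)
    on-fibre : ∀ y i → δ (b i) y * deg (b i) ≡ δ (b i) y * deg y
    on-fibre y i with b i Fin.≟ y
    ... | yes b≡y = cong (λ z → 1 * deg z) b≡y
    ... | no _    = refl

  -- Cauchy–Schwarz against the indicator of B
  labels²≤ : s * s ≤ ∣ B ∣ * shareB
  labels²≤ = subst₂ _≤_ (cong₂ _*_ weighted weighted) (cong₂ _*_ size (sym shareB-by-degree))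
               (cauchy-schwarz (χ B) deg)
    where
    weighted : sum (λ y → χ B y * deg y) ≡ s
    weighted = trans (sum-cong-≗ deg-supported) (sym labels-by-degree)
    size : sum (λ y → χ B y * χ B y) ≡ ∣ B ∣
    size = trans (sum-cong-≗ (λ y → 𝟙-idem (y ∈? B))) (sum-χ B)

  cross : Fin s → Fin s → ℕ
  cross i j = δ (b i) (b j) * 𝟙 (¬? (a i Fin.≟ a j))

  crossPairs : ℕ
  crossPairs = ∑[ i < s ] ∑[ j < s ] cross i j

  share-split : ∀ i j → δ (b i) (b j) ≤ δ i j + cross i j
  share-split i j with a i Fin.≟ a j | b i Fin.≟ b j
  ... | _      | no _   = z≤n
  ... | yes a≡ | yes b≡ = ≤-trans (≤-reflexive (sym (𝟙-true (edges-distinct i j a≡ b≡) (i Fin.≟ j))))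
                                  (m≤m+n (δ i j) _)
  ... | no _   | yes _  = m≤n+m 1 (δ i j)

  -- the pairs (i, i) contribute s, all other sharing pairs are crossing
  shareB≤ : shareB ≤ s + crossPairs
  shareB≤ = begin
    shareB                                               ≤⟨ sum-mono (λ i → sum-mono (share-split i)) ⟩
    ∑[ i < s ] ∑[ j < s ] (δ i j + cross i j)            ≡⟨ sum-cong-≗ (λ i → ∑-distrib-+ (δ i) (cross i)) ⟩
    ∑[ i < s ] (sum (δ i) + sum (cross i))               ≡⟨ ∑-distrib-+ {s} (λ i → sum (δ i)) (λ i → sum (cross i)) ⟩
    ∑[ i < s ] sum (δ i) + crossPairs                    ≡⟨ cong (_+ crossPairs) (trans (sum-cong-≗ {s} sum-δ) (sum-ones s)) ⟩
    s + crossPairs                                       ∎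
    where open ≤-Reasoning

  partner : Fin n → Fin s → ℕ
  partner y i = ∑[ j < s ] (δ (a j) y * cross i j)

  partner-witness : ∀ {y i j} → 1 ≤ δ (a j) y * cross i j → a j ≡ y × b i ≡ b j × a i ≢ a j
  partner-witness {y} {i} {j} pos with 𝟙*-sound (a j Fin.≟ y) pos
  ... | a≡y , pos′ with 𝟙*-sound (b i Fin.≟ b j) pos′
  ...   | b≡ , a≢ = a≡y , b≡ , 𝟙-sound (¬? (a i Fin.≟ a j)) a≢

  -- a label at y sharing i's B-end is unique, as distinct labels name distinct edges
  partner-≤1 : ∀ y i → partner y i ≤ 1
  partner-≤1 y i = sum-≤1
    (λ j → 𝟙*-≤1 (a j Fin.≟ y) (𝟙*-≤1 (b i Fin.≟ b j) (𝟙-≤1 (¬? (a i Fin.≟ a j)))))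
    (λ j j′ p p′ → let (a≡y , b≡ , _) = partner-witness p; (a≡y′ , b≡′ , _) = partner-witness p′
                   in edges-distinct j j′ (trans a≡y (sym a≡y′)) (trans (sym b≡) b≡′))

  partner-outside : ∀ {y} → ¬ y ∈ A → ∀ i → partner y i ≡ 0
  partner-outside y∉A i = sum-zero λ j → 𝟙*-false (a-outside y∉A j) (_ Fin.≟ _) (cross i j)

  fan : Fin n → Fin n → ℕ
  fan x y = ∑[ i < s ] (δ (a i) x * partner y i)

  -- grouping crossing pairs (i, j) by y = a j and then by x = a i
  crossPairs-by-fans : crossPairs ≡ ∑[ y < n ] ∑[ x < n ] fan x y
  crossPairs-by-fans = begin
    crossPairs                          ≡⟨ sum-cong-≗ (λ i → sum-fibres a (cross i)) ⟩
    ∑[ i < s ] ∑[ y < n ] partner y i   ≡⟨ ∑-comm (λ i y → partner y i) ⟩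
    ∑[ y < n ] ∑[ i < s ] partner y i   ≡⟨ sum-cong-≗ (λ y → sum-fibres a (partner y)) ⟩
    ∑[ y < n ] ∑[ x < n ] fan x y       ∎
    where open ≡-Reasoning

  large-fan : ∀ {m x y} → suc m ≤ fan x y → x ≢ y × DoubleFan (suc m) x y
  large-fan {m} {x} {y} large with sum-≥ (suc m) (λ i → δ (a i) x * partner y i)
                                       (λ i → 𝟙*-≤1 (a i Fin.≟ x) (partner-≤1 y i)) large
  ... | g , g-inj , g-pos = x≢y , g , g-inj , at-x , joined
    where
    at-x : ∀ u → a (g u) ≡ x
    at-x u = proj₁ (𝟙*-sound (a (g u) Fin.≟ x) (g-pos u))
    partner-of : ∀ u → ∃ λ j → 1 ≤ δ (a j) y * cross (g u) j
    partner-of u = sum-pos _ (proj₂ (𝟙*-sound (a (g u) Fin.≟ x) (g-pos u)))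
    joined : ∀ u → ∃ λ j → a j ≡ y × b j ≡ b (g u)
    joined u with partner-of u
    ... | j , pos with partner-witness pos
    ...   | a≡y , b≡ , _ = j , a≡y , sym b≡
    x≢y : x ≢ y
    x≢y x≡y with partner-of zero
    ... | j , pos with partner-witness pos
    ...   | a≡y , _ , a≢ = a≢ (trans (at-x zero) (trans x≡y (sym a≡y)))

  fan-bound : ∀ m → (∀ x y → x ≢ y → ¬ DoubleFan (suc m) x y) →
    ∀ x y → fan x y ≤ m * (χ A y * χ A x)
  fan-bound m no-fans x y with y ∈? A | x ∈? A
  ... | yes _ | yes _ = ≤-trans (≮⇒≥ λ large → let (x≢y , double-fan) = large-fan large in no-fans x y x≢y double-fan)
                                (≤-reflexive (sym (*-identityʳ m)))
  ... | no y∉A | _ = ≤-trans (≤-reflexive (sum-zero λ i →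
      trans (cong (δ (a i) x *_) (partner-outside y∉A i)) (*-zeroʳ (δ (a i) x))))
      z≤n
  ... | yes _ | no x∉A = ≤-trans (≤-reflexive (sum-zero λ i →
      𝟙*-false (a-outside x∉A i) (a i Fin.≟ x) (partner y i)))
      z≤n

  crossPairs≤ : ∀ m → (∀ x y → x ≢ y → ¬ DoubleFan (suc m) x y) → crossPairs ≤ m * (∣ A ∣ * ∣ A ∣)
  crossPairs≤ m no-fans = begin
    crossPairs                                          ≡⟨ crossPairs-by-fans ⟩
    ∑[ y < n ] ∑[ x < n ] fan x y                       ≤⟨ sum-mono (λ y → sum-mono (λ x → fan-bound m no-fans x y)) ⟩
    ∑[ y < n ] ∑[ x < n ] (m * (χ A y * χ A x))         ≡⟨ double-sum-scale m (λ y x → χ A y * χ A x) ⟨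
    m * ∑[ y < n ] ∑[ x < n ] (χ A y * χ A x)           ≡⟨ cong (m *_) (sum-*-sum (χ A) (χ A)) ⟨
    m * (sum (χ A) * sum (χ A))                         ≡⟨ cong (λ k → m * (k * k)) (sum-χ A) ⟩
    m * (∣ A ∣ * ∣ A ∣)                                   ∎
    where open ≤-Reasoning

  labels²-bound : ∀ m → (∀ x y → x ≢ y → ¬ DoubleFan (suc m) x y) →
    s * s ≤ ∣ B ∣ * (s + m * (∣ A ∣ * ∣ A ∣))
  labels²-bound m no-fans =
    ≤-trans labels²≤ (*-monoʳ-≤ ∣ B ∣ (≤-trans shareB≤ (+-monoʳ-≤ s (crossPairs≤ m no-fans))))

lookup-injective : ∀ {A : Set} {xs : List A} → AllPairs _≢_ xs →
  ∀ i j → lookup xs i ≡ lookup xs j → i ≡ j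
lookup-injective (_ ∷ _)      zero    zero    _ = refl
lookup-injective (x≢ ∷ _)     zero    (suc j) e = contradiction e (All.lookup x≢ (∈-lookup j))
lookup-injective (x≢ ∷ _)     (suc i) zero    e = contradiction (sym e) (All.lookup x≢ (∈-lookup i))
lookup-injective (_ ∷ unique) (suc i) (suc j) e = cong suc (lookup-injective unique i j e)

module SColours {n} (c : Colouring n) (c-sym : Symmetric c)
  (A B : Subset n) (disjoint : Empty (A ∩ B)) where

  -- label i is the i-th colour of S_c(A, B); kept opaque so that the type checker
  -- never unfolds the list S_c(A, B)
  opaque
    col : Fin (σ c A B) → ℕ
    col = lookup (Sc c A B)

    col-in-S : ∀ i → InS c A B (col i)
    col-in-S i = proj₂ (∈-filter⁻ (InS? c A B) {xs = edgeColours c}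
      (∈-deduplicate⁻ _ (filter (InS? c A B) (edgeColours c)) (∈-lookup i)))

    col-injective : ∀ i j → col i ≡ col j → i ≡ j
    col-injective = lookup-injective (deduplicate-! (filter (InS? c A B) (edgeColours c)))

  representative : ∀ i → Σ (Fin n) λ p → Σ (Fin n) λ q → p ∈ A × q ∈ B × c p q ≡ col i
  representative i with col-in-S i
  ... | (u , v , u≢v , cuv) , only-AB with only-AB u v u≢v cuv
  ...   | inj₁ (u∈A , v∈B) = u , v , u∈A , v∈B , cuv
  ...   | inj₂ (u∈B , v∈A) = v , u , v∈A , u∈B , trans (c-sym v u) cuv

  a b : Fin (σ c A B) → Fin n
  a i = proj₁ (representative i)
  b i = proj₁ (proj₂ (representative i))

  a∈A : ∀ i → a i ∈ A
  a∈A i = proj₁ (proj₂ (proj₂ (representative i)))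

  b∈B : ∀ i → b i ∈ B
  b∈B i = proj₁ (proj₂ (proj₂ (proj₂ (representative i))))

  c-ab : ∀ i → c (a i) (b i) ≡ col i
  c-ab i = proj₂ (proj₂ (proj₂ (proj₂ (representative i))))

  edges-distinct : ∀ i j → a i ≡ a j → b i ≡ b j → i ≡ j
  edges-distinct i j a≡ b≡ = col-injective i j (trans (sym (c-ab i)) (trans (cong₂ c a≡ b≡) (c-ab j)))

  open LabelledEdges A B a b a∈A b∈B edges-distinct public

  not-in-both : ∀ {z} → z ∈ A → z ∈ B → ⊥
  not-in-both {z} z∈A z∈B = disjoint (z , x∈p∩q⁺ (z∈A , z∈B))

  A≢B : ∀ {p q} → p ∈ A → q ∈ B → p ≢ q
  A≢B p∈A p∈B refl = not-in-both p∈A p∈B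

  Labelled : Fin n → Fin n → Set
  Labelled p q = ∃ λ i → a i ≡ p × b i ≡ q

  labelled-colour : ∀ {p q} (ℓ : Labelled p q) → c p q ≡ col (proj₁ ℓ)
  labelled-colour (i , refl , refl) = c-ab i

  labelled-A : ∀ {p q} → Labelled p q → p ∈ A
  labelled-A (i , refl , _) = a∈A i

  labelled-B : ∀ {p q} → Labelled p q → q ∈ B
  labelled-B (i , _ , refl) = b∈B i

  labelled-distinct : ∀ {p q p′ q′} → Labelled p q → Labelled p′ q′ →
    p ≢ p′ ⊎ q ≢ q′ → c p q ≢ c p′ q′
  labelled-distinct (i , refl , refl) (j , refl , refl) differ same
    with col-injective i j (trans (sym (c-ab i)) (trans same (c-ab j))) | differ
  ... | refl | inj₁ a≢ = a≢ refl
  ... | refl | inj₂ b≢ = b≢ refl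

  inside-A : ∀ {p q p′ q′} → p ∈ A → q ∈ A → p ≢ q → Labelled p′ q′ → c p q ≢ c p′ q′
  inside-A p∈A q∈A p≢q ℓ same with proj₂ (col-in-S (proj₁ ℓ)) _ _ p≢q (trans same (labelled-colour ℓ))
  ... | inj₁ (_ , q∈B) = not-in-both q∈A q∈B
  ... | inj₂ (p∈B , _) = not-in-both p∈A p∈B

  inside-B : ∀ {p q p′ q′} → p ∈ B → q ∈ B → p ≢ q → Labelled p′ q′ → c p′ q′ ≢ c p q
  inside-B p∈B q∈B p≢q ℓ same with proj₂ (col-in-S (proj₁ ℓ)) _ _ p≢q (trans (sym same) (labelled-colour ℓ))
  ... | inj₁ (p∈A , _) = not-in-both p∈A p∈B
  ... | inj₂ (_ , q∈A) = not-in-both q∈A q∈B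

  module _ (no-rainbow : ∀ x y z w → ¬ RainbowK4 c x y z w) where

    -- if the four A–B edges of {x, y, z, w} are labelled, they carry four distinct colours
    -- absent from xy and zw, so avoiding a rainbow K₄ forces c x y ≡ c z w
    across-K4 : ∀ {x y z w} → x ≢ y → z ≢ w →
      Labelled x z → Labelled x w → Labelled y z → Labelled y w → c x y ≡ c z w
    across-K4 {x} {y} {z} {w} x≢y z≢w ℓxz ℓxw ℓyz ℓyw with c x y ≟ c z w
    ... | yes same  = same
    ... | no differ = ⊥-elim (no-rainbow x y z w (distinct ,
          inside-A x∈A y∈A x≢y ℓxz , inside-A x∈A y∈A x≢y ℓxw ,
          inside-A x∈A y∈A x≢y ℓyz , inside-A x∈A y∈A x≢y ℓyw , differ ,
          labelled-distinct ℓxz ℓxw (inj₂ z≢w) , labelled-distinct ℓxz ℓyz (inj₁ x≢y) ,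
          labelled-distinct ℓxz ℓyw (inj₁ x≢y) , inside-B z∈B w∈B z≢w ℓxz ,
          labelled-distinct ℓxw ℓyz (inj₁ x≢y) , labelled-distinct ℓxw ℓyw (inj₁ x≢y) ,
          inside-B z∈B w∈B z≢w ℓxw ,
          labelled-distinct ℓyz ℓyw (inj₂ z≢w) , inside-B z∈B w∈B z≢w ℓyz ,
          inside-B z∈B w∈B z≢w ℓyw))
      where
      x∈A : x ∈ A
      x∈A = labelled-A ℓxz
      y∈A : y ∈ A
      y∈A = labelled-A ℓyz
      z∈B : z ∈ B
      z∈B = labelled-B ℓxz
      w∈B : w ∈ B
      w∈B = labelled-B ℓxw
      distinct : Distinct4 x y z w
      distinct = x≢y , A≢B x∈A z∈B , A≢B x∈A w∈B , A≢B y∈A z∈B , A≢B y∈A w∈B , z≢w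

    fan⇒mono : ∀ {m x y} → x ≢ y → DoubleFan m x y → MonoKm c m
    fan⇒mono {m} {x} {y} x≢y (g , g-inj , at-x , joined) = ends , ends-inj , c x y , mono
      where
      ends : Fin m → Fin n
      ends u = b (g u)
      ends-inj : ∀ u v → ends u ≡ ends v → u ≡ v
      ends-inj u v e = g-inj (edges-distinct (g u) (g v) (trans (at-x u) (sym (at-x v))) e)
      from-x : ∀ u → Labelled x (ends u)
      from-x u = g u , at-x u , refl
      mono : ∀ u v → u ≢ v → c (ends u) (ends v) ≡ c x y
      mono u v u≢v = sym (across-K4 x≢y (u≢v ∘ ends-inj u v) (from-x u) (from-x v) (joined u) (joined v))

square-bound : ∀ {s α β k} m → s * s ≤ β * (s + m * (α * α)) → s ≤ α * β → α ≤ k → β ≤ k →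
  s ^ 2 ≤ k ^ 3 * suc m
square-bound {s} {α} {β} {k} m s²≤ s≤ α≤k β≤k = begin
  s ^ 2                         ≡⟨ cong (s *_) (*-identityʳ s) ⟩
  s * s                         ≤⟨ s²≤ ⟩
  β * (s + m * (α * α))         ≤⟨ *-mono-≤ β≤k (+-mono-≤ (≤-trans s≤ (*-mono-≤ α≤k β≤k))
                                                          (*-monoʳ-≤ m (*-mono-≤ α≤k α≤k))) ⟩
  k * (k * k + m * (k * k))     ≡⟨ regroup k m ⟩
  k ^ 3 * suc m                 ∎
  where
  open ≤-Reasoning
  -- k ^ 3 unfolds to k * (k * (k * 1))
  regroup : ∀ p q → p * (p * p + q * (p * p)) ≡ p * (p * (p * 1)) * (1 + q)
  regroup = solve-∀

lemma2 : (m n : ℕ) → 3 ≤ m → (c : Colouring n) → Admissible m c →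
    (k : ℕ) → 1 ≤ k → (A B : Subset n) → Empty (A ∩ B) →
    ∣ A ∣ ≤ k → ∣ B ∣ ≤ k →
    σ c A B ^ 2 ≤ k ^ 3 * m
lemma2 (suc m) n (s≤s _) c (c-sym , no-mono , no-rainbow) k _ A B disjoint |A|≤k |B|≤k =
  square-bound m (labels²-bound m no-double-fans) labels≤ |A|≤k |B|≤k
  where
  open SColours c c-sym A B disjoint
  no-double-fans : ∀ x y → x ≢ y → ¬ DoubleFan (suc m) x y
  no-double-fans x y x≢y double-fan = no-mono (fan⇒mono no-rainbow x≢y double-fan)
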